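{- Let $d\leq (n-3)/2$, let $D=\{\{l_1,r_1\},\dots,\{l_d,r_d\}\}$ be a set of pairwise disjoint pairs of elements of $[n]$ with $l_k<r_k$, and let $b\in\{0,1\}^D$. Define $x_b$ on the variables of $\mathrm{LOP}_n$ by $x_b(P_{l_k,r_k})=b(\{l_k,r_k\})$ and $x_b(P_{r_k,l_k})=1-b(\{l_k,r_k\})$ for each $k$, and $x_b(P_{i,j})=1/2$ for all other $i\neq j$. Then $x_b$ satisfies all inequalities of $\mathrm{LOP}_n$.
   Context: $\mathrm{LOP}_n$ is the set of integer linear inequalities over variables $P_{i,j}$ ($i\neq j\in[n]$): $P_{i,j}+P_{j,i}=1$ for all $i\neq j$; $P_{i,k}-P_{i,j}-P_{j,k}\geq -1$ for all pairwise distinct $i,j,k\in[n]$; and $\sum_{i\in[n],\,i\neq j}P_{i,j}\geq 1$ for all $j\in[n]$. -}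

module Defs where

open import Data.Nat using (ℕ; zero; suc)
open import Data.Fin using (Fin; zero; suc; _<_)
open import Data.Fin.Properties using (_≟_)
open import Data.Product using (_×_; _,_; proj₁; proj₂)
open import Data.Bool using (Bool; true; false; if_then_else_; _∧_)
open import Relation.Nullary using (¬_; does)
open import Relation.Binary.PropositionalEquality using (_≡_)
open import Data.Rational using (ℚ; 0ℚ; 1ℚ; ½; _+_; _-_; -_; _≤_)

bval : Bool → ℚ
bval true  = 1ℚ
bval false = 0ℚ

sumFin : ∀ {n} → (Fin n → ℚ) → ℚ
sumFin {zero}  f = 0ℚ
sumFin {suc n} f = f zero + sumFin {n} (λ i → f (suc i))

sumExcept : ∀ {n} → (Fin n → ℚ) → Fin n → ℚ
sumExcept f j = sumFin (λ i → if does (i ≟ j) then 0ℚ else f i)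

-- An assignment P to the variables P_{i,j} (i ≠ j) of LOP_n;
-- the diagonal values P i i are never used.
-- "P satisfies all inequalities of LOP_n".
record SatisfiesLOP (n : ℕ) (P : Fin n → Fin n → ℚ) : Set where
  field
    antisymmetry : ∀ i j → ¬ i ≡ j → P i j + P j i ≡ 1ℚ
    transitivity : ∀ i j k → ¬ i ≡ j → ¬ j ≡ k → ¬ i ≡ k →
                   - 1ℚ ≤ (P i k - P i j) - P j k
    noMinimum    : ∀ j → 1ℚ ≤ sumExcept (λ i → P i j) j

-- The pairs D = {{l_1,r_1},…,{l_d,r_d}} are given as an indexed family
-- D k = (l_k , r_k).  They satisfy l_k < r_k and are pairwise disjoint.
OrderedPairs : (n d : ℕ) → (Fin d → Fin n × Fin n) → Set
OrderedPairs n d D = ∀ k → proj₁ (D k) < proj₂ (D k)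

PairwiseDisjoint : (n d : ℕ) → (Fin d → Fin n × Fin n) → Set
PairwiseDisjoint n d D = ∀ k k' → ¬ k ≡ k' →
    (¬ proj₁ (D k) ≡ proj₁ (D k')) × (¬ proj₁ (D k) ≡ proj₂ (D k'))
  × (¬ proj₂ (D k) ≡ proj₁ (D k')) × (¬ proj₂ (D k) ≡ proj₂ (D k'))

xb : ∀ {n d} → (Fin d → Fin n × Fin n) → (Fin d → Bool) → Fin n → Fin n → ℚ
xb {n} {zero}  D b i j = ½
xb {n} {suc d} D b i j =
  if does (proj₁ (D zero) ≟ i) ∧ does (proj₂ (D zero) ≟ j) then bval (b zero)
  else if does (proj₂ (D zero) ≟ i) ∧ does (proj₁ (D zero) ≟ j) then 1ℚ - bval (b zero)
  else xb {n} {d} (λ k → D (suc k)) (λ k → b (suc k)) i j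

-- Since the pairs of D are disjoint, every vertex has at most one
-- partner, so among the three pairs spanned by distinct i, j, k at most one
-- is in D: the transitivity inequality involves at most one bit, and it
-- holds in each such case.  In column j at most one entry differs from ½, and
-- n ≥ 2d + 3 leaves three vertices besides j (two if d = 0), so two entries
-- equal ½ and the column sums to at least 1.
module Submission where

open import Defs
open import Data.Nat using (ℕ; zero; suc; _+_; _*_; _≤_; s≤s; z≤n)
import Data.Nat.Properties as ℕ
open import Data.Fin using (Fin; zero; suc; punchIn)
open import Data.Fin.Properties using (_≟_; <⇒≢; punchIn-injective; punchInᵢ≢i)
open import Data.Product using (_×_; _,_; proj₁; proj₂; ∃)
open import Data.Sum using (_⊎_; inj₁; inj₂)
open import Data.Bool using (Bool; true; false; if_then_else_)
open import Data.Empty using (⊥; ⊥-elim)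
open import Function using (_∘_)
open import Relation.Nullary using (yes; no; does)
open import Relation.Nullary.Decidable using (True; toWitness; _×-dec_; dec-true; dec-false)
open import Relation.Binary.PropositionalEquality using (_≡_; _≢_; refl; sym; trans; cong; cong₂)
open import Data.Rational as ℚ using (ℚ; 0ℚ; 1ℚ; ½)
open import Data.Rational.Properties
  using (_≤?_; ≤-refl; ≤-trans; ≤-reflexive; +-mono-≤; +-monoʳ-≤; +-identityˡ; +-identityʳ; +-comm)

≤-by-evaluation : {p q : ℚ} {p≤q : True (p ≤? q)} → p ℚ.≤ q
≤-by-evaluation {p≤q = p≤q} = toWitness p≤q

sumFin-nonneg : ∀ {n} (f : Fin n → ℚ) → (∀ i → 0ℚ ℚ.≤ f i) → 0ℚ ℚ.≤ sumFin f
sumFin-nonneg {zero}  f f≥0 = ≤-refl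
sumFin-nonneg {suc n} f f≥0 = +-mono-≤ (f≥0 zero) (sumFin-nonneg (f ∘ suc) (f≥0 ∘ suc))

sumFin-≥-term : ∀ {n} (f : Fin n → ℚ) → (∀ i → 0ℚ ℚ.≤ f i) → ∀ a → f a ℚ.≤ sumFin f
sumFin-≥-term {suc n} f f≥0 zero = ≤-trans (≤-reflexive (sym (+-identityʳ (f zero))))
  (+-monoʳ-≤ (f zero) (sumFin-nonneg (f ∘ suc) (f≥0 ∘ suc)))
sumFin-≥-term {suc n} f f≥0 (suc a) = ≤-trans (≤-reflexive (sym (+-identityˡ (f (suc a)))))
  (+-mono-≤ (f≥0 zero) (sumFin-≥-term (f ∘ suc) (f≥0 ∘ suc) a))

sumFin-≥-pair : ∀ {n} (f : Fin n → ℚ) → (∀ i → 0ℚ ℚ.≤ f i) →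
                ∀ {a c} → a ≢ c → f a ℚ.+ f c ℚ.≤ sumFin f
sumFin-≥-pair {suc n} f f≥0 {zero}  {zero}  a≢c = ⊥-elim (a≢c refl)
sumFin-≥-pair {suc n} f f≥0 {zero}  {suc c} a≢c =
  +-monoʳ-≤ (f zero) (sumFin-≥-term (f ∘ suc) (f≥0 ∘ suc) c)
sumFin-≥-pair {suc n} f f≥0 {suc a} {zero}  a≢c = ≤-trans (≤-reflexive (+-comm (f (suc a)) (f zero)))
  (+-monoʳ-≤ (f zero) (sumFin-≥-term (f ∘ suc) (f≥0 ∘ suc) a))
sumFin-≥-pair {suc n} f f≥0 {suc a} {suc c} a≢c =
  ≤-trans (≤-reflexive (sym (+-identityˡ (f (suc a) ℚ.+ f (suc c)))))
          (+-mono-≤ (f≥0 zero) (sumFin-≥-pair (f ∘ suc) (f≥0 ∘ suc) (a≢c ∘ cong suc)))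

sumExcept-≥-pair : ∀ {n} (f : Fin n → ℚ) (j : Fin n) → (∀ i → i ≢ j → 0ℚ ℚ.≤ f i) →
                   ∀ {a c} → a ≢ c → a ≢ j → c ≢ j → f a ℚ.+ f c ℚ.≤ sumExcept f j
sumExcept-≥-pair f j f≥0 {a} {c} a≢c a≢j c≢j =
  ≤-trans (≤-reflexive (cong₂ ℚ._+_ (sym (dropped-≢ a≢j)) (sym (dropped-≢ c≢j))))
          (sumFin-≥-pair dropped dropped≥0 a≢c)
  where
  dropped : Fin _ → ℚ
  dropped i = if does (i ≟ j) then 0ℚ else f i
  dropped-≢ : ∀ {i} → i ≢ j → dropped i ≡ f i
  dropped-≢ {i} i≢j rewrite dec-false (i ≟ j) i≢j = refl
  dropped≥0 : ∀ i → 0ℚ ℚ.≤ dropped i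
  dropped≥0 i with i ≟ j
  ... | yes _   = ≤-refl
  ... | no  i≢j = f≥0 i i≢j

column-≥1 : ∀ {m} (f : Fin (suc m) → ℚ) (j : Fin (suc m)) → (∀ i → i ≢ j → 0ℚ ℚ.≤ f i) →
            ∀ {a c} → a ≢ c → f (punchIn j a) ≡ ½ → f (punchIn j c) ≡ ½ → 1ℚ ℚ.≤ sumExcept f j
column-≥1 f j f≥0 a≢c fa≡½ fc≡½ =
  ≤-trans (≤-reflexive (cong₂ ℚ._+_ (sym fa≡½) (sym fc≡½)))
          (sumExcept-≥-pair f j f≥0 (a≢c ∘ punchIn-injective j _ _) (punchInᵢ≢i j _) (punchInᵢ≢i j _))

Joins : ∀ {n} → Fin n × Fin n → Fin n → Fin n → Set
Joins p i j = (proj₁ p ≡ i × proj₂ p ≡ j) ⊎ (proj₂ p ≡ i × proj₁ p ≡ j)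

Matched : ∀ {n d} → (Fin d → Fin n × Fin n) → Fin n → Fin n → Set
Matched D i j = ∃ λ k → Joins (D k) i j

joins-sym : ∀ {n} {p : Fin n × Fin n} {i j} → Joins p i j → Joins p j i
joins-sym (inj₁ (l≡i , r≡j)) = inj₂ (r≡j , l≡i)
joins-sym (inj₂ (r≡i , l≡j)) = inj₁ (l≡j , r≡i)

matched-sym : ∀ {n d} {D : Fin d → Fin n × Fin n} {i j} → Matched D i j → Matched D j i
matched-sym (k , joins) = k , joins-sym joins

joins-partner : ∀ {n} {p : Fin n × Fin n} → proj₁ p ≢ proj₂ p →
                ∀ {a b c} → Joins p a b → Joins p a c → b ≡ c
joins-partner _   (inj₁ (_ , r≡b)) (inj₁ (_ , r≡c)) = trans (sym r≡b) r≡c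
joins-partner l≢r (inj₁ (l≡a , _)) (inj₂ (r≡a , _)) = ⊥-elim (l≢r (trans l≡a (sym r≡a)))
joins-partner l≢r (inj₂ (r≡a , _)) (inj₁ (l≡a , _)) = ⊥-elim (l≢r (trans l≡a (sym r≡a)))
joins-partner _   (inj₂ (_ , l≡b)) (inj₂ (_ , l≡c)) = trans (sym l≡b) l≡c

module _ {n d} {D : Fin d → Fin n × Fin n} (disjoint : PairwiseDisjoint n d D) where

  joins-disjoint : ∀ {k k'} → k ≢ k' → ∀ {a b c} → Joins (D k) a b → Joins (D k') a c → ⊥
  joins-disjoint k≢k' (inj₁ (l≡a , _)) (inj₁ (l'≡a , _)) = proj₁ (disjoint _ _ k≢k') (trans l≡a (sym l'≡a))
  joins-disjoint k≢k' (inj₁ (l≡a , _)) (inj₂ (r'≡a , _)) = proj₁ (proj₂ (disjoint _ _ k≢k')) (trans l≡a (sym r'≡a))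
  joins-disjoint k≢k' (inj₂ (r≡a , _)) (inj₁ (l'≡a , _)) = proj₁ (proj₂ (proj₂ (disjoint _ _ k≢k'))) (trans r≡a (sym l'≡a))
  joins-disjoint k≢k' (inj₂ (r≡a , _)) (inj₂ (r'≡a , _)) = proj₂ (proj₂ (proj₂ (disjoint _ _ k≢k'))) (trans r≡a (sym r'≡a))

  partner-unique : OrderedPairs n d D → ∀ {a b c} → Matched D a b → Matched D a c → b ≡ c
  partner-unique ordered (k , ab) (k' , ac) with k ≟ k'
  ... | yes refl = joins-partner (<⇒≢ (ordered k)) ab ac
  ... | no  k≢k' = ⊥-elim (joins-disjoint k≢k' ab ac)

data Shape (M : Set) : ℚ → ℚ → Set where
  halves : Shape M ½ ½
  bits   : M → (β : Bool) → Shape M (bval β) (1ℚ ℚ.- bval β)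

shape-map : ∀ {M N x y} → (M → N) → Shape M x y → Shape N x y
shape-map f halves     = halves
shape-map f (bits m β) = bits (f m) β

shape-sum : ∀ {M x y} → Shape M x y → x ℚ.+ y ≡ 1ℚ
shape-sum halves         = refl
shape-sum (bits _ true)  = refl
shape-sum (bits _ false) = refl

data Value (M : Set) : ℚ → Set where
  half : Value M ½
  bit  : M → (β : Bool) → Value M (bval β)

shape-value : ∀ {M x y} → Shape M x y → Value M x
shape-value halves     = half
shape-value (bits m β) = bit m β

value-nonneg : ∀ {M x} → Value M x → 0ℚ ℚ.≤ x
value-nonneg half          = ≤-by-evaluation
value-nonneg (bit _ true)  = ≤-by-evaluation
value-nonneg (bit _ false) = ≤-by-evaluation

data AtMostOneBit : ℚ → ℚ → ℚ → Set where
  no-bit     : AtMostOneBit ½ ½ ½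
  first-bit  : ∀ β → AtMostOneBit (bval β) ½ ½
  second-bit : ∀ β → AtMostOneBit ½ (bval β) ½
  third-bit  : ∀ β → AtMostOneBit ½ ½ (bval β)

at-most-one-bit : ∀ {A B C x y z} → (A → B → ⊥) → (A → C → ⊥) → (B → C → ⊥) →
                  Value A x → Value B y → Value C z → AtMostOneBit x y z
at-most-one-bit ¬AB _   _   (bit a _) (bit b _) _         = ⊥-elim (¬AB a b)
at-most-one-bit _   ¬AC _   (bit a _) _         (bit c _) = ⊥-elim (¬AC a c)
at-most-one-bit _   _   ¬BC _         (bit b _) (bit c _) = ⊥-elim (¬BC b c)
at-most-one-bit _   _   _   half      half      half      = no-bit
at-most-one-bit _   _   _   (bit _ β) half      half      = first-bit β
at-most-one-bit _   _   _   half      (bit _ β) half      = second-bit β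
at-most-one-bit _   _   _   half      half      (bit _ β) = third-bit β

triangle : ∀ {x y z} → AtMostOneBit x y z → ℚ.- 1ℚ ℚ.≤ (z ℚ.- x) ℚ.- y
triangle no-bit             = ≤-by-evaluation
triangle (first-bit true)   = ≤-by-evaluation
triangle (first-bit false)  = ≤-by-evaluation
triangle (second-bit true)  = ≤-by-evaluation
triangle (second-bit false) = ≤-by-evaluation
triangle (third-bit true)   = ≤-by-evaluation
triangle (third-bit false)  = ≤-by-evaluation

two-halves : ∀ {x y z} → AtMostOneBit x y z →
             (x ≡ ½ × y ≡ ½) ⊎ (x ≡ ½ × z ≡ ½) ⊎ (y ≡ ½ × z ≡ ½)
two-halves no-bit         = inj₁ (refl , refl)
two-halves (first-bit _)  = inj₂ (inj₂ (refl , refl))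
two-halves (second-bit _) = inj₂ (inj₁ (refl , refl))
two-halves (third-bit _)  = inj₁ (refl , refl)

xb-shape : ∀ {n d} (D : Fin d → Fin n × Fin n) (b : Fin d → Bool) {i j : Fin n} → i ≢ j →
           Shape (Matched D i j) (xb D b i j) (xb D b j i)
xb-shape {d = zero} D b i≢j = halves
xb-shape {d = suc d} D b {i} {j} i≢j
  with proj₁ (D zero) ≟ i ×-dec proj₂ (D zero) ≟ j | proj₂ (D zero) ≟ i ×-dec proj₁ (D zero) ≟ j
... | yes (l≡i , r≡j) | _
  rewrite dec-true (proj₁ (D zero) ≟ i ×-dec proj₂ (D zero) ≟ j) (l≡i , r≡j)
        | dec-false (proj₁ (D zero) ≟ j ×-dec proj₂ (D zero) ≟ i) (λ (l≡j , _) → i≢j (trans (sym l≡i) l≡j))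
        | dec-true (proj₂ (D zero) ≟ j ×-dec proj₁ (D zero) ≟ i) (r≡j , l≡i)
  = bits (zero , inj₁ (l≡i , r≡j)) (b zero)
... | no ¬fwd | yes (r≡i , l≡j)
  rewrite dec-false (proj₁ (D zero) ≟ i ×-dec proj₂ (D zero) ≟ j) ¬fwd
        | dec-true (proj₂ (D zero) ≟ i ×-dec proj₁ (D zero) ≟ j) (r≡i , l≡j)
        | dec-true (proj₁ (D zero) ≟ j ×-dec proj₂ (D zero) ≟ i) (l≡j , r≡i)
  with b zero
... | true  = bits (zero , inj₂ (r≡i , l≡j)) false
... | false = bits (zero , inj₂ (r≡i , l≡j)) true
xb-shape {d = suc d} D b {i} {j} i≢j | no ¬fwd | no ¬bwd
  rewrite dec-false (proj₁ (D zero) ≟ i ×-dec proj₂ (D zero) ≟ j) ¬fwd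
        | dec-false (proj₂ (D zero) ≟ i ×-dec proj₁ (D zero) ≟ j) ¬bwd
        | dec-false (proj₁ (D zero) ≟ j ×-dec proj₂ (D zero) ≟ i) (λ (l≡j , r≡i) → ¬bwd (r≡i , l≡j))
        | dec-false (proj₂ (D zero) ≟ j ×-dec proj₁ (D zero) ≟ i) (λ (r≡j , l≡i) → ¬fwd (l≡i , r≡j))
  = shape-map (λ (k , joins) → suc k , joins) (xb-shape (D ∘ suc) (b ∘ suc) i≢j)

xb-value : ∀ {n d} (D : Fin d → Fin n × Fin n) (b : Fin d → Bool) {i j : Fin n} → i ≢ j →
           Value (Matched D i j) (xb D b i j)
xb-value D b = shape-value ∘ xb-shape D b

xb-nonneg : ∀ {n d} (D : Fin d → Fin n × Fin n) (b : Fin d → Bool) (j : Fin n) →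
            ∀ i → i ≢ j → 0ℚ ℚ.≤ xb D b i j
xb-nonneg D b j i = value-nonneg ∘ xb-value D b

xb-triangle : ∀ {n d} (D : Fin d → Fin n × Fin n) → OrderedPairs n d D → PairwiseDisjoint n d D →
              (b : Fin d → Bool) → ∀ {i j k} → i ≢ j → j ≢ k → i ≢ k →
              AtMostOneBit (xb D b i j) (xb D b j k) (xb D b i k)
xb-triangle D ordered disjoint b i≢j j≢k i≢k =
  at-most-one-bit (λ ij jk → i≢k (partner-unique disjoint ordered (matched-sym ij) jk))
                  (λ ij ik → j≢k (partner-unique disjoint ordered ij ik))
                  (λ jk ik → i≢j (partner-unique disjoint ordered (matched-sym ik) (matched-sym jk)))
                  (xb-value D b i≢j) (xb-value D b j≢k) (xb-value D b i≢k)

xb-column-≥1 : ∀ {n d} → 2 * d + 3 ≤ n → (D : Fin d → Fin n × Fin n) → OrderedPairs n d D →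
               PairwiseDisjoint n d D → (b : Fin d → Bool) →
               ∀ j → 1ℚ ℚ.≤ sumExcept (λ i → xb D b i j) j
xb-column-≥1 {d = zero} (s≤s (s≤s (s≤s _))) D _ _ b j =
  column-≥1 _ j (xb-nonneg D b j) {zero} {suc zero} (λ ()) refl refl
xb-column-≥1 {d = suc d} 2d+3≤n D ordered disjoint b j
  with ℕ.≤-trans (ℕ.+-monoˡ-≤ 3 (ℕ.*-monoʳ-≤ 2 (s≤s (z≤n {d})))) 2d+3≤n
... | s≤s (s≤s (s≤s (s≤s _)))
  with two-halves (at-most-one-bit (distinct {zero} {suc zero} (λ ()))
                                   (distinct {zero} {suc (suc zero)} (λ ()))
                                   (distinct {suc zero} {suc (suc zero)} (λ ()))
                                   (value zero) (value (suc zero)) (value (suc (suc zero))))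
  where
  value : ∀ a → Value (Matched D (punchIn j a) j) (xb D b (punchIn j a) j)
  value a = xb-value D b (punchInᵢ≢i j a)
  distinct : ∀ {a c} → a ≢ c → Matched D (punchIn j a) j → Matched D (punchIn j c) j → ⊥
  distinct {a} {c} a≢c aj cj =
    a≢c (punchIn-injective j a c (partner-unique disjoint ordered (matched-sym aj) (matched-sym cj)))
... | inj₁ (h₀ , h₁)        = column-≥1 _ j (xb-nonneg D b j) {zero} {suc zero} (λ ()) h₀ h₁
... | inj₂ (inj₁ (h₀ , h₂)) = column-≥1 _ j (xb-nonneg D b j) {zero} {suc (suc zero)} (λ ()) h₀ h₂
... | inj₂ (inj₂ (h₁ , h₂)) = column-≥1 _ j (xb-nonneg D b j) {suc zero} {suc (suc zero)} (λ ()) h₁ h₂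

mainTheorem19 : (n d : ℕ) → 2 * d + 3 ≤ n →
                (D : Fin d → Fin n × Fin n) → OrderedPairs n d D → PairwiseDisjoint n d D →
                (b : Fin d → Bool) →
                SatisfiesLOP n (xb D b)
mainTheorem19 n d 2d+3≤n D ordered disjoint b = record
  { antisymmetry = λ i j i≢j → shape-sum (xb-shape D b i≢j)
  ; transitivity = λ i j k i≢j j≢k i≢k → triangle (xb-triangle D ordered disjoint b i≢j j≢k i≢k)
  ; noMinimum    = xb-column-≥1 2d+3≤n D ordered disjoint b
  }
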